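{- There exists a bijection $\phi:\mathcal{T}\to\mathcal{V}\cap\prod\mathcal{Q}$ such that $\gamma(\phi(m))=m$ for all $m\in\mathcal{T}$.
   Context: $\mathcal{T}$ is the set of squarefree monomials in $\Bbbk[t_{ij}:1\le i<j\le n]$ that are products of at most one variable from each set $T_k=\{t_{1,k+1},t_{2,k+1},\dots,t_{k,k+1}\}$, $1\le k\le n-1$. In $\Bbbk[u_i,v_{ij},w_{ij}]$ ($1\le i\le n$, $1\le i<j\le n$), let $V_k=\{u_k,v_{1k},w_{1k},\dots,v_{k-1,k},w_{k-1,k}\}$ and let $\mathcal{V}$ be the set of squarefree monomials that are products of at most one variable from each $V_1,\dots,V_n$. Let $\mathcal{Q}=\{u_iw_{ij}\}_{i<j}\cup\{w_{ij}w_{ik}\}_{i<j<k}\cup\{v_{ij}w_{jk}\}_{i<j<k}$, and $\prod\mathcal{Q}$ the set of all finite products of elements of $\mathcal{Q}$ (including $1$). $\gamma:\Bbbk[u_i,v_{ij},w_{ij}]\to\Bbbk[t_{ij}]$ is the algebra map with $u_i\mapsto1$, $v_{ij}\mapsto t_{ij}$, $w_{ij}\mapsto t_{ij}$. -}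

module Defs where

open import Data.Nat using (ℕ; zero; suc; _+_; _*_; _≤_)
open import Data.Fin using (Fin; _<_)
import Data.Fin as Fin
import Data.Fin.Properties as FinP
open import Data.Bool using (if_then_else_)
open import Data.List using (List; []; _∷_)
open import Data.Product using (Σ; _×_; _,_; proj₁; ∃-syntax)
open import Relation.Nullary using (does)
open import Relation.Binary.PropositionalEquality using (_≡_; _≗_; refl; sym; trans)
open import Relation.Binary.Bundles using (Setoid)

δ : ∀ {n} → Fin n → Fin n → ℕ
δ i a = if does (i Fin.≟ a) then 1 else 0

-- Variables of k[t_ij : 1 ≤ i < j ≤ n]  (indices are Fin n, i.e. 0-based)

data TVar (n : ℕ) : Set where
  t : (i j : Fin n) → .(i < j) → TVar n

-- the block of t_ij is indexed by j  (T_k = {t_{i,k+1} : i ≤ k}, so j = k+1)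
tBlock : ∀ {n} → TVar n → Fin n
tBlock (t i j _) = j

TMon : ℕ → Set
TMon n = TVar n → ℕ

data VVar (n : ℕ) : Set where
  u : (i : Fin n) → VVar n
  v : (i j : Fin n) → .(i < j) → VVar n
  w : (i j : Fin n) → .(i < j) → VVar n

vBlock : ∀ {n} → VVar n → Fin n
vBlock (u i) = i
vBlock (v i j _) = j
vBlock (w i j _) = j

VMon : ℕ → Set
VMon n = VVar n → ℕ

varMon : ∀ {n} → VVar n → VMon n
varMon (u i) (u a) = δ i a
varMon (v i j _) (v a b _) = δ i a * δ j b
varMon (w i j _) (w a b _) = δ i a * δ j b
varMon _ _ = 0

oneMon : ∀ {n} → VMon n
oneMon _ = 0

_·_ : ∀ {n} → VMon n → VMon n → VMon n
(m · m') x = m x + m' x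

AtMostOnePerBlock : ∀ {V B : Set} → (V → B) → (V → ℕ) → Set
AtMostOnePerBlock {V} blk m =
  (∀ x → m x ≤ 1) ×
  (∀ x y → blk x ≡ blk y → 1 ≤ m x → 1 ≤ m y → x ≡ y)

InT : ∀ {n} → TMon n → Set
InT = AtMostOnePerBlock tBlock

InV : ∀ {n} → VMon n → Set
InV = AtMostOnePerBlock vBlock

data QElem (n : ℕ) : Set where
  uw : (i j : Fin n) → .(i < j) → QElem n
  ww : (i j k : Fin n) → .(i < j) → .(j < k) → QElem n
  vw : (i j k : Fin n) → .(i < j) → .(j < k) → QElem n

qMon : ∀ {n} → QElem n → VMon n
qMon (uw i j p) = varMon (u i) · varMon (w i j p)
qMon (ww i j k p q) = varMon (w i j p) · varMon (w i k (FinP.<-trans p q))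
qMon (vw i j k p q) = varMon (v i j p) · varMon (w j k q)

prodQ : ∀ {n} → List (QElem n) → VMon n
prodQ [] = oneMon
prodQ (q ∷ qs) = qMon q · prodQ qs

InProdQ : ∀ {n} → VMon n → Set
InProdQ {n} m = ∃[ qs ] (prodQ {n} qs ≗ m)

-- γ on monomials: u_i ↦ 1, v_ij ↦ t_ij, w_ij ↦ t_ij

γ : ∀ {n} → VMon n → TMon n
γ m (t i j p) = m (v i j p) + m (w i j p)

𝒯 : ℕ → Setoid _ _
𝒯 n = record
  { Carrier = Σ (TMon n) InT
  ; _≈_ = λ a b → proj₁ a ≗ proj₁ b
  ; isEquivalence = record
    { refl = λ _ → refl
    ; sym = λ p x → sym (p x)
    ; trans = λ p q x → trans (p x) (q x) } }

𝒱∩∏𝒬 : ℕ → Setoid _ _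
𝒱∩∏𝒬 n = record
  { Carrier = Σ (VMon n) (λ m → InV m × InProdQ m)
  ; _≈_ = λ a b → proj₁ a ≗ proj₁ b
  ; isEquivalence = record
    { refl = λ _ → refl
    ; sym = λ p x → sym (p x)
    ; trans = λ p q x → trans (p x) (q x) } }

-- For a monomial y of 𝒱 and an index j let uvDeg y j be its degree in {u_j} ∪ {v_ij : i < j} and
-- wOutDeg y j its degree in {w_jk : k > j}.  Every generator in 𝒬 adds 2 to the weight
-- uvDeg + wOutDeg at one index and 0 elsewhere, so on ∏𝒬 all weights are even; conversely a
-- monomial of 𝒱 with even weights is a product of generators, split off greedily
-- (u_j w_jk, v_ij w_jk or w_jk w_jk′).
--
-- A monomial y of 𝒱 is recovered from m = γ(y) and the bits s_j = uvDeg y j ∈ {0,1}: its factor in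
-- block j is u_j if s_j = 1 and no t_ij divides m, v_ij if s_j = 1 and t_ij divides m, and w_ij if
-- s_j = 0 and t_ij divides m.  Even weights say s_j ≡ wOutDeg y j (mod 2), and wOutDeg y j is read
-- off from m and the bits s_k with k > j.  So downward induction on j shows that γ is injective on
-- 𝒱 ∩ ∏𝒬, and the same recursion, used as a definition, gives for every m ∈ 𝒯 the monomial φ(m)
-- with γ(φ(m)) = m.
module Submission where

open import Defs
open import Data.Fin using (Fin; zero; suc; punchIn)
import Data.Fin as Fin
open import Data.Fin.Induction using (>-wellFounded)
import Data.Fin.Properties as Fin
open import Data.List using (List; []; _∷_)
open import Data.Nat using (ℕ; zero; suc; _+_; _*_; _∸_; _≤_; _<_; z≤n; s≤s; s≤s⁻¹; _≤?_; parity)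
open import Data.Nat.Properties
open import Algebra.Properties.CommutativeSemigroup +-commutativeSemigroup using (interchange)
open import Algebra.Properties.Semiring.Sum +-*-semiring
  using (sum; sum-syntax; sum-cong-≗; ∑-distrib-+; sum-replicate-zero; sum-remove; *-distribˡ-sum)
open import Data.Parity using (Parity; 0ℙ; 1ℙ; _⁻¹)
import Data.Parity as ℙ
import Data.Parity.Properties as ℙ
open import Data.Product using (Σ; ∃; ∃₂; _×_; _,_; proj₁; proj₂)
open import Data.Sum using (_⊎_; inj₁; inj₂)
open import Function using (_∘_; case_of_)
open import Function.Bundles using (Bijection)
open import Induction.WellFounded using (module All; module FixPoint)
open import Level using (0ℓ)
open import Relation.Binary.Bundles using (Setoid)
open import Relation.Binary.Definitions using (tri<; tri≈; tri>)
open import Relation.Binary.PropositionalEquality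
open import Relation.Nullary using (¬_; yes; no; contradiction)
open import Relation.Nullary.Decidable using (recompute)

private
  variable
    n : ℕ
    i j : Fin n

1≰⇒≡0 : {a : ℕ} → ¬ 1 ≤ a → a ≡ 0
1≰⇒≡0 = n<1⇒n≡0 ∘ ≰⇒>

δ≤1 : (a b : Fin n) → δ a b ≤ 1
δ≤1 a b with a Fin.≟ b
... | yes _ = s≤s z≤n
... | no  _ = z≤n

δ-refl : (a : Fin n) → δ a a ≡ 1
δ-refl a with a Fin.≟ a
... | yes _   = refl
... | no  a≢a = contradiction refl a≢a

sum-zero : {f : Fin n → ℕ} → (∀ i → f i ≡ 0) → sum f ≡ 0
sum-zero {n} f≗0 = trans (sum-cong-≗ f≗0) (sum-replicate-zero n)

sum-δ : (a : Fin n) (f : Fin n → ℕ) → ∑[ i < n ] (δ a i * f i) ≡ f a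
sum-δ {suc n} zero f = trans (cong₂ _+_ (*-identityˡ (f zero)) (sum-replicate-zero n)) (+-identityʳ (f zero))
sum-δ (suc a) f = sum-δ a (f ∘ suc)

term≤sum : (f : Fin n → ℕ) (i : Fin n) → f i ≤ sum f
term≤sum f zero    = m≤m+n (f zero) _
term≤sum f (suc i) = ≤-trans (term≤sum (f ∘ suc) i) (m≤n+m _ (f zero))

∃-positive-term : (f : Fin n → ℕ) → 1 ≤ sum f → ∃ λ i → 1 ≤ f i
∃-positive-term {suc n} f 1≤∑ with 1 ≤? f zero
... | yes 1≤f₀ = zero , 1≤f₀
... | no  1≰f₀ =
  let i , 1≤fᵢ = ∃-positive-term (f ∘ suc)
                   (≤-trans 1≤∑ (≤-reflexive (cong (_+ sum (f ∘ suc)) (1≰⇒≡0 1≰f₀))))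
  in suc i , 1≤fᵢ

∃-other-positive-term : (f : Fin n → ℕ) (i : Fin n) → f i < sum f → ∃ λ k → k ≢ i × 1 ≤ f k
∃-other-positive-term {suc n} f i fᵢ<∑ =
  let k , 1≤fₖ = ∃-positive-term (f ∘ punchIn i) (+-cancelˡ-≤ (f i) 1 _
                   (≤-trans (≤-reflexive (+-comm (f i) 1)) (≤-trans fᵢ<∑ (≤-reflexive (sum-remove f)))))
  in punchIn i k , Fin.punchInᵢ≢i i k , 1≤fₖ

sum≤1 : (f : Fin n → ℕ) → (∀ i → f i ≤ 1) → (∀ i k → 1 ≤ f i → 1 ≤ f k → i ≡ k) →
        sum f ≤ 1
sum≤1 f f≤1 unique with 1 ≤? sum f
... | no 1≰∑ = ≤-trans (≤-reflexive (1≰⇒≡0 1≰∑)) z≤n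
... | yes 1≤∑ with ∃-positive-term f 1≤∑
...   | i , 1≤fᵢ with sum f ≤? f i
...     | yes ∑≤fᵢ = ≤-trans ∑≤fᵢ (f≤1 i)
...     | no  ∑≰fᵢ =
  let k , k≢i , 1≤fₖ = ∃-other-positive-term f i (≰⇒> ∑≰fᵢ)
  in contradiction (unique k i 1≤fₖ 1≤fᵢ) k≢i

-- Opaque, so that the unifier solves the arguments of `when< i j f` instead of unfolding it into
-- a stuck `with`-function.
opaque
  when< : (i j : Fin n) → (.(i Fin.< j) → ℕ) → ℕ
  when< i j f with i Fin.<? j
  ... | yes i<j = f i<j
  ... | no  _   = 0

opaque
  unfolding when<

  when<-yes : {f : .(i Fin.< j) → ℕ} .(i<j : i Fin.< j) → when< i j f ≡ f i<j
  when<-yes {i = i} {j} i<j with i Fin.<? j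
  ... | yes _   = refl
  ... | no  i≮j = contradiction (recompute (i Fin.<? j) i<j) i≮j

  when<-cong : {f g : .(i Fin.< j) → ℕ} → (∀ i<j → f i<j ≡ g i<j) → when< i j f ≡ when< i j g
  when<-cong {i = i} {j} f≗g with i Fin.<? j
  ... | yes i<j = f≗g i<j
  ... | no  _   = refl

  when<-zero : when< i j (λ _ → 0) ≡ 0
  when<-zero {i = i} {j} with i Fin.<? j
  ... | yes _ = refl
  ... | no  _ = refl

  when<-+ : (f g : .(i Fin.< j) → ℕ) → when< i j (λ p → f p + g p) ≡ when< i j f + when< i j g
  when<-+ {i = i} {j} f g with i Fin.<? j
  ... | yes _ = refl
  ... | no  _ = refl

  when<-*ˡ : (c : ℕ) (f : .(i Fin.< j) → ℕ) → when< i j (λ p → c * f p) ≡ c * when< i j f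
  when<-*ˡ {i = i} {j} c f with i Fin.<? j
  ... | yes _ = refl
  ... | no  _ = sym (*-zeroʳ c)

  when<-≤ : {f : .(i Fin.< j) → ℕ} {c : ℕ} → (∀ i<j → f i<j ≤ c) → when< i j f ≤ c
  when<-≤ {i = i} {j} f≤c with i Fin.<? j
  ... | yes i<j = f≤c i<j
  ... | no  _   = z≤n

  when<-positive : {f : .(i Fin.< j) → ℕ} → 1 ≤ when< i j f → Σ (i Fin.< j) λ i<j → 1 ≤ f i<j
  when<-positive {i = i} {j} 1≤f with i Fin.<? j
  ... | yes i<j = i<j , 1≤f

  when<-δ : {a b : Fin n} → .(a ≡ b → i Fin.< j) → when< i j (λ _ → δ a b) ≡ δ a b
  when<-δ {i = i} {j} {a} {b} a≡b⇒i<j with i Fin.<? j | a Fin.≟ b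
  ... | yes _   | _       = refl
  ... | no  _   | no  _   = refl
  ... | no  i≮j | yes a≡b = contradiction (recompute (i Fin.<? j) (a≡b⇒i<j a≡b)) i≮j

module _ {n : ℕ} where

  vDeg : VMon n → Fin n → ℕ
  vDeg y j = ∑[ i < n ] when< i j (λ i<j → y (v i j i<j))

  uvDeg : VMon n → Fin n → ℕ
  uvDeg y j = y (u j) + vDeg y j

  wOutSlot : VMon n → Fin n → Fin n → ℕ
  wOutSlot y j k = when< j k (λ j<k → y (w j k j<k))

  wOutDeg : VMon n → Fin n → ℕ
  wOutDeg y j = ∑[ k < n ] wOutSlot y j k

  wInDeg : VMon n → Fin n → ℕ
  wInDeg y j = ∑[ i < n ] when< i j (λ i<j → y (w i j i<j))

  weight : VMon n → Fin n → ℕ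
  weight y j = uvDeg y j + wOutDeg y j

  deg : TMon n → Fin n → ℕ
  deg m j = ∑[ i < n ] when< i j (λ i<j → m (t i j i<j))

  -- `uvDeg y j` is definitionally the sum of these n + 1 terms.
  uvSlot : VMon n → Fin n → Fin (suc n) → ℕ
  uvSlot y j zero    = y (u j)
  uvSlot y j (suc i) = when< i j (λ i<j → y (v i j i<j))

  uvDeg-cong : {y y′ : VMon n} → y ≗ y′ → ∀ j → uvDeg y j ≡ uvDeg y′ j
  uvDeg-cong {y} {y′} y≗y′ j = sum-cong-≗ {suc n} slot-cong
    where
    slot-cong : uvSlot y j ≗ uvSlot y′ j
    slot-cong zero    = y≗y′ (u j)
    slot-cong (suc i) = when<-cong λ _ → y≗y′ _

  wOutDeg-cong : {y y′ : VMon n} → y ≗ y′ → ∀ j → wOutDeg y j ≡ wOutDeg y′ j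
  wOutDeg-cong y≗y′ j = sum-cong-≗ {n} λ k → when<-cong λ _ → y≗y′ _

  weight-cong : {y y′ : VMon n} → y ≗ y′ → ∀ j → weight y j ≡ weight y′ j
  weight-cong y≗y′ j = cong₂ _+_ (uvDeg-cong y≗y′ j) (wOutDeg-cong y≗y′ j)

  uvDeg-· : (y y′ : VMon n) (j : Fin n) → uvDeg (y · y′) j ≡ uvDeg y j + uvDeg y′ j
  uvDeg-· y y′ j = trans (sum-cong-≗ {suc n} slot-·) (∑-distrib-+ (uvSlot y j) (uvSlot y′ j))
    where
    slot-· : ∀ s → uvSlot (y · y′) j s ≡ uvSlot y j s + uvSlot y′ j s
    slot-· zero    = refl
    slot-· (suc i) = when<-+ _ _

  wOutDeg-· : (y y′ : VMon n) (j : Fin n) → wOutDeg (y · y′) j ≡ wOutDeg y j + wOutDeg y′ j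
  wOutDeg-· y y′ j = trans (sum-cong-≗ {n} λ k → when<-+ _ _) (∑-distrib-+ {n} _ _)

  weight-· : (y y′ : VMon n) (j : Fin n) → weight (y · y′) j ≡ weight y j + weight y′ j
  weight-· y y′ j =
    trans (cong₂ _+_ (uvDeg-· y y′ j) (wOutDeg-· y y′ j))
          (interchange (uvDeg y j) (uvDeg y′ j) (wOutDeg y j) (wOutDeg y′ j))

  deg-cong : {m m′ : TMon n} → m ≗ m′ → ∀ j → deg m j ≡ deg m′ j
  deg-cong m≗m′ j = sum-cong-≗ {n} λ i → when<-cong λ _ → m≗m′ _

  deg-γ : (y : VMon n) (j : Fin n) → deg (γ y) j ≡ vDeg y j + wInDeg y j
  deg-γ y j = trans (sum-cong-≗ {n} λ i → when<-+ _ _) (∑-distrib-+ {n} _ _)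

  vDeg-oneMon : (j : Fin n) → vDeg oneMon j ≡ 0
  vDeg-oneMon j = sum-zero {n} λ i → when<-zero

  wOutDeg-oneMon : (j : Fin n) → wOutDeg oneMon j ≡ 0
  wOutDeg-oneMon j = sum-zero {n} λ k → when<-zero

  u≤uvDeg : (y : VMon n) (j : Fin n) → y (u j) ≤ uvDeg y j
  u≤uvDeg y j = term≤sum (uvSlot y j) zero

  v≤uvDeg : (y : VMon n) {i j : Fin n} .(i<j : i Fin.< j) → y (v i j i<j) ≤ uvDeg y j
  v≤uvDeg y {i} {j} i<j = ≤-trans (≤-reflexive (sym (when<-yes i<j))) (term≤sum (uvSlot y j) (suc i))

  w≤wOutDeg : (y : VMon n) {j k : Fin n} .(j<k : j Fin.< k) → y (w j k j<k) ≤ wOutDeg y j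
  w≤wOutDeg y {j} {k} j<k = ≤-trans (≤-reflexive (sym (when<-yes j<k))) (term≤sum (wOutSlot y j) k)

  t≤deg : (m : TMon n) {i j : Fin n} .(i<j : i Fin.< j) → m (t i j i<j) ≤ deg m j
  t≤deg m {i} {j} i<j = ≤-trans (≤-reflexive (sym (when<-yes i<j))) (term≤sum {n} _ i)

  uvDeg-positive : (y : VMon n) (j : Fin n) → 1 ≤ uvDeg y j →
                   1 ≤ y (u j) ⊎ ∃₂ λ i (i<j : i Fin.< j) → 1 ≤ y (v i j i<j)
  uvDeg-positive y j 1≤uvDeg with ∃-positive-term (uvSlot y j) 1≤uvDeg
  ... | zero  , 1≤yu   = inj₁ 1≤yu
  ... | suc i , 1≤slot = inj₂ (i , when<-positive 1≤slot)

  wOutDeg-positive : (y : VMon n) (j : Fin n) → 1 ≤ wOutDeg y j →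
                     ∃₂ λ k (j<k : j Fin.< k) → 1 ≤ y (w j k j<k)
  wOutDeg-positive y j 1≤wOutDeg =
    let k , 1≤wₖ = ∃-positive-term (wOutSlot y j) 1≤wOutDeg in k , when<-positive 1≤wₖ

  anchor : VVar n → Fin n
  anchor (u a)     = a
  anchor (v a b _) = b
  anchor (w a b _) = a

  weight-varMon : (x : VVar n) (j : Fin n) → weight (varMon x) j ≡ δ (anchor x) j
  weight-varMon (u a) j =
    trans (cong₂ _+_ (cong (δ a j +_) (vDeg-oneMon j)) (wOutDeg-oneMon j))
          (trans (+-identityʳ _) (+-identityʳ _))
  weight-varMon (v a b a<b) j = trans (cong₂ _+_ vDeg-v (wOutDeg-oneMon j)) (+-identityʳ _)
    where
    vDeg-v : ∑[ i < n ] when< i j (λ _ → δ a i * δ b j) ≡ δ b j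
    vDeg-v = begin
      ∑[ i < n ] when< i j (λ _ → δ a i * δ b j)   ≡⟨ sum-cong-≗ {n} (λ i → when<-*ˡ (δ a i) _) ⟩
      ∑[ i < n ] (δ a i * when< i j (λ _ → δ b j)) ≡⟨ sum-δ a _ ⟩
      when< a j (λ _ → δ b j)                      ≡⟨ when<-δ {a = b} {b = j} (λ { refl → a<b }) ⟩
      δ b j                                        ∎
      where open ≡-Reasoning
  weight-varMon (w a b a<b) j = cong₂ _+_ (vDeg-oneMon j) wOutDeg-w
    where
    wOutDeg-w : ∑[ k < n ] when< j k (λ _ → δ a j * δ b k) ≡ δ a j
    wOutDeg-w = begin
      ∑[ k < n ] when< j k (λ _ → δ a j * δ b k)
        ≡⟨ sum-cong-≗ {n} (λ k → trans (when<-cong λ _ → *-comm (δ a j) (δ b k))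
                                        (when<-*ˡ (δ b k) _)) ⟩
      ∑[ k < n ] (δ b k * when< j k (λ _ → δ a j))
        ≡⟨ sum-δ b _ ⟩
      when< j b (λ _ → δ a j)
        ≡⟨ when<-δ {a = a} {b = j} (λ { refl → a<b }) ⟩
      δ a j ∎
      where open ≡-Reasoning

  weight-varMon-pair : (x x′ : VVar n) (j : Fin n) →
                       weight (varMon x · varMon x′) j ≡ δ (anchor x) j + δ (anchor x′) j
  weight-varMon-pair x x′ j =
    trans (weight-· (varMon x) (varMon x′) j) (cong₂ _+_ (weight-varMon x j) (weight-varMon x′ j))

  qAnchor : QElem n → Fin n
  qAnchor (uw i _ _)     = i
  qAnchor (ww i _ _ _ _) = i
  qAnchor (vw _ j _ _ _) = j

  weight-qMon : (q : QElem n) (j : Fin n) → weight (qMon q) j ≡ δ (qAnchor q) j + δ (qAnchor q) j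
  weight-qMon (uw i j i<j)       = weight-varMon-pair (u i) (w i j i<j)
  weight-qMon (ww i j k i<j j<k) = weight-varMon-pair (w i j i<j) (w i k (Fin.<-trans i<j j<k))
  weight-qMon (vw i j k i<j j<k) = weight-varMon-pair (v i j i<j) (w j k j<k)

  EvenWeight : VMon n → Set
  EvenWeight y = ∀ j → parity (weight y j) ≡ 0ℙ

  parity-weight-· : (y y′ : VMon n) (j : Fin n) →
                    parity (weight (y · y′) j) ≡ parity (weight y j) ℙ.+ parity (weight y′ j)
  parity-weight-· y y′ j = trans (cong parity (weight-· y y′ j)) (ℙ.+-homo-+ (weight y j) _)

  evenWeight-· : {y y′ : VMon n} → EvenWeight y → EvenWeight y′ → EvenWeight (y · y′)
  evenWeight-· {y} {y′} even even′ j = trans (parity-weight-· y y′ j) (cong₂ ℙ._+_ (even j) (even′ j))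

  evenWeight-cancelˡ : {y y′ : VMon n} → EvenWeight y → EvenWeight (y · y′) → EvenWeight y′
  evenWeight-cancelˡ {y} {y′} even even-· j =
    trans (cong (ℙ._+ parity (weight y′ j)) (sym (even j))) (trans (sym (parity-weight-· y y′ j)) (even-· j))

  evenWeight-cong : {y y′ : VMon n} → y ≗ y′ → EvenWeight y → EvenWeight y′
  evenWeight-cong y≗y′ even j = trans (cong parity (sym (weight-cong y≗y′ j))) (even j)

  evenWeight-qMon : (q : QElem n) → EvenWeight (qMon q)
  evenWeight-qMon q j = begin
    parity (weight (qMon q) j)          ≡⟨ cong parity (weight-qMon q j) ⟩
    parity (δ c j + δ c j)              ≡⟨ ℙ.+-homo-+ (δ c j) (δ c j) ⟩
    parity (δ c j) ℙ.+ parity (δ c j)   ≡⟨ ℙ.p+p≡0ℙ (parity (δ c j)) ⟩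
    0ℙ                                  ∎
    where
    open ≡-Reasoning
    c = qAnchor q

  evenWeight-prodQ : (qs : List (QElem n)) → EvenWeight (prodQ qs)
  evenWeight-prodQ []       j = cong parity (cong₂ _+_ (vDeg-oneMon j) (wOutDeg-oneMon j))
  evenWeight-prodQ (q ∷ qs) = evenWeight-· {qMon q} {prodQ qs} (evenWeight-qMon q) (evenWeight-prodQ qs)

  InProdQ⇒EvenWeight : {y : VMon n} → InProdQ y → EvenWeight y
  InProdQ⇒EvenWeight (qs , prodQ≗y) = evenWeight-cong prodQ≗y (evenWeight-prodQ qs)

  bit : Parity → ℕ
  bit 0ℙ = 0
  bit 1ℙ = 1

  bit≤1 : ∀ p → bit p ≤ 1
  bit≤1 0ℙ = z≤n
  bit≤1 1ℙ = s≤s z≤n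

  parity-bit : ∀ p → parity (bit p) ≡ p
  parity-bit 0ℙ = refl
  parity-bit 1ℙ = refl

  bit-*-≤ : ∀ p a → bit p * a ≤ a
  bit-*-≤ 0ℙ a = z≤n
  bit-*-≤ 1ℙ a = ≤-reflexive (+-identityʳ a)

  bit-*-positive : ∀ p {a} → 1 ≤ bit p * a → p ≡ 1ℙ × 1 ≤ a
  bit-*-positive 1ℙ {a} 1≤a+0 = refl , ≤-trans 1≤a+0 (≤-reflexive (+-identityʳ a))

  bit-split : ∀ p a → bit p * a + bit (p ⁻¹) * a ≡ a
  bit-split 0ℙ a = +-identityʳ a
  bit-split 1ℙ a = trans (+-identityʳ _) (+-identityʳ a)

  bit-∸-+ : ∀ p {d} → d ≤ 1 → (bit p ∸ d) + bit p * d ≡ bit p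
  bit-∸-+ 0ℙ {d} _   = trans (+-identityʳ (0 ∸ d)) (0∸n≡0 d)
  bit-∸-+ 1ℙ {d} d≤1 = trans (cong (1 ∸ d +_) (+-identityʳ d)) (m∸n+n≡m d≤1)

  build : TMon n → (Fin n → Parity) → VMon n
  build m s (u j)     = bit (s j) ∸ deg m j
  build m s (v i j p) = bit (s j) * m (t i j p)
  build m s (w i j p) = bit (s j ⁻¹) * m (t i j p)

  source : VVar n → Fin n
  source (u j)     = j
  source (v i _ _) = i
  source (w i _ _) = i

  tSource : TVar n → Fin n
  tSource (t i _ _) = i

  module _ {y : VMon n} (y∈V : InV y) where

    block-exclusive : {x x′ : VVar n} → vBlock x ≡ vBlock x′ → x ≢ x′ → 1 ≤ y x → y x′ ≡ 0
    block-exclusive same x≢x′ 1≤yx = 1≰⇒≡0 λ 1≤yx′ → x≢x′ (proj₂ y∈V _ _ same 1≤yx 1≤yx′)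

    uvDeg≤1 : ∀ j → uvDeg y j ≤ 1
    uvDeg≤1 j = sum≤1 (uvSlot y j) slot≤1 slot-unique
      where
      slot≤1 : ∀ s → uvSlot y j s ≤ 1
      slot≤1 zero    = proj₁ y∈V (u j)
      slot≤1 (suc i) = when<-≤ λ _ → proj₁ y∈V _
      slot-unique : ∀ s s′ → 1 ≤ uvSlot y j s → 1 ≤ uvSlot y j s′ → s ≡ s′
      slot-unique zero    zero     _   _   = refl
      slot-unique zero    (suc i)  1≤u 1≤v  with () ← proj₂ y∈V _ _ refl 1≤u (proj₂ (when<-positive 1≤v))
      slot-unique (suc i) zero     1≤v 1≤u  with () ← proj₂ y∈V _ _ refl 1≤u (proj₂ (when<-positive 1≤v))
      slot-unique (suc i) (suc i′) 1≤v 1≤v′ = cong (suc ∘ source)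
        (proj₂ y∈V _ _ refl (proj₂ (when<-positive 1≤v)) (proj₂ (when<-positive 1≤v′)))

    free⇒≡0 : ∀ {a j} → a ≤ uvDeg y j → uvDeg y j ≡ 0 → a ≡ 0
    free⇒≡0 a≤uvDeg free = n≤0⇒n≡0 (≤-trans a≤uvDeg (≤-reflexive free))

    occupied⇒w≡0 : ∀ {i j} .(i<j : i Fin.< j) → 1 ≤ uvDeg y j → y (w i j i<j) ≡ 0
    occupied⇒w≡0 {i} {j} i<j 1≤uvDeg with uvDeg-positive y j 1≤uvDeg
    ... | inj₁ 1≤yu           = block-exclusive refl (λ ()) 1≤yu
    ... | inj₂ (_ , _ , 1≤yv) = block-exclusive refl (λ ()) 1≤yv

    occupied⇒deg-γ≡vDeg : ∀ j → 1 ≤ uvDeg y j → deg (γ y) j ≡ vDeg y j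
    occupied⇒deg-γ≡vDeg j 1≤uvDeg = begin
      deg (γ y) j             ≡⟨ deg-γ y j ⟩
      vDeg y j + wInDeg y j   ≡⟨ cong (vDeg y j +_) (sum-zero {n} λ i →
                                   trans (when<-cong λ i<j → occupied⇒w≡0 i<j 1≤uvDeg) when<-zero) ⟩
      vDeg y j + 0            ≡⟨ +-identityʳ _ ⟩
      vDeg y j                ∎
      where open ≡-Reasoning

    reconstruct : y ≗ build (γ y) (parity ∘ uvDeg y)
    reconstruct (u j) with n≤1⇒n≡0∨n≡1 (uvDeg≤1 j)
    ... | inj₁ free     rewrite free     = trans (free⇒≡0 (u≤uvDeg y j) free) (sym (0∸n≡0 (deg (γ y) j)))
    ... | inj₂ occupied rewrite occupied = begin
      y (u j)               ≡⟨ m+n∸n≡m (y (u j)) (vDeg y j) ⟨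
      uvDeg y j ∸ vDeg y j  ≡⟨ cong₂ _∸_ occupied (sym (occupied⇒deg-γ≡vDeg j 1≤uvDeg)) ⟩
      1 ∸ deg (γ y) j       ∎
      where
      open ≡-Reasoning
      1≤uvDeg = ≤-reflexive (sym occupied)
    reconstruct (v i j i<j) with n≤1⇒n≡0∨n≡1 (uvDeg≤1 j)
    ... | inj₁ free     rewrite free     = free⇒≡0 (v≤uvDeg y i<j) free
    ... | inj₂ occupied rewrite occupied = sym (trans (+-identityʳ _)
      (trans (cong (y (v i j i<j) +_) (occupied⇒w≡0 i<j (≤-reflexive (sym occupied)))) (+-identityʳ _)))
    reconstruct (w i j i<j) with n≤1⇒n≡0∨n≡1 (uvDeg≤1 j)
    ... | inj₁ free     rewrite free     =
      sym (trans (+-identityʳ _) (cong (_+ y (w i j i<j)) (free⇒≡0 (v≤uvDeg y i<j) free)))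
    ... | inj₂ occupied rewrite occupied = occupied⇒w≡0 i<j (≤-reflexive (sym occupied))

    γ-InT : InT (γ y)
    γ-InT = γ≤1 , γ-unique
      where
      γ≤1 : ∀ x → γ y x ≤ 1
      γ≤1 (t i j i<j) with 1 ≤? y (v i j i<j)
      ... | yes 1≤yv = ≤-trans (≤-reflexive (cong (y (v i j i<j) +_) (block-exclusive refl (λ ()) 1≤yv)))
                               (≤-trans (≤-reflexive (+-identityʳ _)) (proj₁ y∈V (v i j i<j)))
      ... | no  1≰yv = ≤-trans (≤-reflexive (cong (_+ y (w i j i<j)) (1≰⇒≡0 1≰yv)))
                               (proj₁ y∈V (w i j i<j))

      γ-support : ∀ {i j} .{i<j : i Fin.< j} → 1 ≤ γ y (t i j i<j) →
                  ∃ λ x → vBlock x ≡ j × source x ≡ i × 1 ≤ y x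
      γ-support {i} {j} {i<j} 1≤γ with 1 ≤? y (v i j i<j)
      ... | yes 1≤yv = v i j i<j , refl , refl , 1≤yv
      ... | no  1≰yv = w i j i<j , refl , refl ,
                       ≤-trans 1≤γ (≤-reflexive (cong (_+ y (w i j i<j)) (1≰⇒≡0 1≰yv)))

      t-cong : ∀ {i i′ j} .{i<j : i Fin.< j} .{i′<j : i′ Fin.< j} → i ≡ i′ →
               t i j i<j ≡ t i′ j i′<j
      t-cong refl = refl

      γ-unique : ∀ x x′ → tBlock x ≡ tBlock x′ → 1 ≤ γ y x → 1 ≤ γ y x′ → x ≡ x′
      γ-unique (t i j _) (t i′ .j _) refl 1≤γ 1≤γ′ =
        let x  , jx  , ix  , 1≤yx  = γ-support 1≤γ
            x′ , jx′ , ix′ , 1≤yx′ = γ-support 1≤γ′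
            x≡x′ = proj₂ y∈V x x′ (trans jx (sym jx′)) 1≤yx 1≤yx′
        in t-cong (trans (sym ix) (trans (cong source x≡x′) ix′))

  deg≤1 : {m : TMon n} → InT m → ∀ j → deg m j ≤ 1
  deg≤1 {m} m∈T j = sum≤1 {n} _ (λ i → when<-≤ λ _ → proj₁ m∈T _) λ i i′ 1≤mᵢ 1≤mᵢ′ →
    cong tSource (proj₂ m∈T _ _ refl (proj₂ (when<-positive 1≤mᵢ)) (proj₂ (when<-positive 1≤mᵢ′)))

  γ-cong : {y y′ : VMon n} → y ≗ y′ → γ y ≗ γ y′
  γ-cong y≗y′ (t i j _) = cong₂ _+_ (y≗y′ _) (y≗y′ _)

  γ-build : (m : TMon n) (s : Fin n → Parity) → γ (build m s) ≗ m
  γ-build m s (t i j i<j) = bit-split (s j) (m (t i j i<j))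

  build-cong : {m m′ : TMon n} {s s′ : Fin n → Parity} → m ≗ m′ → s ≗ s′ →
               build m s ≗ build m′ s′
  build-cong m≗m′ s≗s′ (u j)     = cong₂ _∸_ (cong bit (s≗s′ j)) (deg-cong m≗m′ j)
  build-cong m≗m′ s≗s′ (v i j _) = cong₂ _*_ (cong bit (s≗s′ j)) (m≗m′ _)
  build-cong m≗m′ s≗s′ (w i j _) = cong₂ _*_ (cong (bit ∘ _⁻¹) (s≗s′ j)) (m≗m′ _)

  uvDeg-build : {m : TMon n} → InT m → (s : Fin n → Parity) → ∀ j → uvDeg (build m s) j ≡ bit (s j)
  uvDeg-build {m} m∈T s j = begin
    (bit (s j) ∸ deg m j) + ∑[ i < n ] when< i j (λ i<j → bit (s j) * m (t i j i<j))
      ≡⟨ cong (bit (s j) ∸ deg m j +_) (sum-cong-≗ {n} λ i → when<-*ˡ (bit (s j)) _) ⟩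
    (bit (s j) ∸ deg m j) + ∑[ i < n ] (bit (s j) * when< i j (λ i<j → m (t i j i<j)))
      ≡⟨ cong (bit (s j) ∸ deg m j +_) (*-distribˡ-sum {n} (bit (s j)) (λ i → when< i j λ i<j → m (t i j i<j))) ⟨
    (bit (s j) ∸ deg m j) + bit (s j) * deg m j
      ≡⟨ bit-∸-+ (s j) (deg≤1 m∈T j) ⟩
    bit (s j) ∎
    where open ≡-Reasoning

  build-InV : {m : TMon n} → InT m → (s : Fin n → Parity) → InV (build m s)
  build-InV {m} m∈T s = build≤1 , build-unique
    where
    build≤1 : ∀ x → build m s x ≤ 1
    build≤1 (u j)       = ≤-trans (m∸n≤m _ (deg m j)) (bit≤1 (s j))
    build≤1 (v i j i<j) = ≤-trans (bit-*-≤ (s j) _) (proj₁ m∈T _)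
    build≤1 (w i j i<j) = ≤-trans (bit-*-≤ (s j ⁻¹) _) (proj₁ m∈T _)

    u-excludes-t : ∀ {i j} .{i<j : i Fin.< j} → 1 ≤ build m s (u j) → ¬ 1 ≤ m (t i j i<j)
    u-excludes-t {j = j} {i<j} 1≤bu 1≤m = contradiction
      (≤-trans 1≤m (≤-trans (t≤deg m i<j) (≤-reflexive deg≡0))) λ ()
      where deg≡0 = n<1⇒n≡0 (<-≤-trans (m∸n≢0⇒n<m (m<n⇒n≢0 1≤bu)) (bit≤1 (s j)))

    v-excludes-w : ∀ {i i′ j} .{i<j : i Fin.< j} .{i′<j : i′ Fin.< j} →
                   1 ≤ build m s (v i j i<j) → ¬ 1 ≤ build m s (w i′ j i′<j)
    v-excludes-w {j = j} 1≤bv 1≤bw =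
      ℙ.p≢p⁻¹ (s j) (trans (proj₁ (bit-*-positive (s j) 1≤bv))
                           (sym (proj₁ (bit-*-positive (s j ⁻¹) 1≤bw))))

    v⇒t : ∀ {i j} .{i<j : i Fin.< j} → 1 ≤ build m s (v i j i<j) → 1 ≤ m (t i j i<j)
    v⇒t {j = j} = proj₂ ∘ bit-*-positive (s j)

    w⇒t : ∀ {i j} .{i<j : i Fin.< j} → 1 ≤ build m s (w i j i<j) → 1 ≤ m (t i j i<j)
    w⇒t {j = j} = proj₂ ∘ bit-*-positive (s j ⁻¹)

    same-t : ∀ {i i′ j} .{i<j : i Fin.< j} .{i′<j : i′ Fin.< j} →
             1 ≤ m (t i j i<j) → 1 ≤ m (t i′ j i′<j) → i ≡ i′
    same-t 1≤m 1≤m′ = cong tSource (proj₂ m∈T _ _ refl 1≤m 1≤m′)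

    build-unique : ∀ x x′ → vBlock x ≡ vBlock x′ → 1 ≤ build m s x → 1 ≤ build m s x′ → x ≡ x′
    build-unique (u j)     (u .j)      refl _ _  = refl
    build-unique (u j)     (v i .j _)  refl h h′ = contradiction (v⇒t h′) (u-excludes-t h)
    build-unique (u j)     (w i .j _)  refl h h′ = contradiction (w⇒t h′) (u-excludes-t h)
    build-unique (v i j _) (u .j)      refl h h′ = contradiction (v⇒t h) (u-excludes-t h′)
    build-unique (w i j _) (u .j)      refl h h′ = contradiction (w⇒t h) (u-excludes-t h′)
    build-unique (v i j _) (w i′ .j _) refl h h′ = contradiction h′ (v-excludes-w h)
    build-unique (w i j _) (v i′ .j _) refl h h′ = contradiction h (v-excludes-w h′)
    build-unique (v i j p) (v i′ .j p′) refl h h′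
      with refl ← same-t (v⇒t {i<j = p} h) (v⇒t {i<j = p′} h′) = refl
    build-unique (w i j p) (w i′ .j p′) refl h h′
      with refl ← same-t (w⇒t {i<j = p} h) (w⇒t {i<j = p′} h′) = refl

  Consistent : TMon n → (Fin n → Parity) → Set
  Consistent m s = ∀ j → s j ≡ parity (wOutDeg (build m s) j)

  wOutDeg-build-cong : {m m′ : TMon n} {s s′ : Fin n → Parity} {j : Fin n} → m ≗ m′ →
                       (∀ {k} → j Fin.< k → s k ≡ s′ k) →
                       wOutDeg (build m s) j ≡ wOutDeg (build m′ s′) j
  wOutDeg-build-cong m≗m′ s≡s′ =
    sum-cong-≗ {n} λ k → when<-cong λ j<k → cong₂ _*_ (cong (bit ∘ _⁻¹) (s≡s′ j<k)) (m≗m′ _)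

  consistent-unique : {m m′ : TMon n} {s s′ : Fin n → Parity} →
                      m ≗ m′ → Consistent m s → Consistent m′ s′ → s ≗ s′
  consistent-unique {m} {m′} {s} {s′} m≗m′ s-cons s′-cons =
    All.wfRec >-wellFounded 0ℓ (λ j → s j ≡ s′ j) step
    where
    step : ∀ j → (∀ {k} → j Fin.< k → s k ≡ s′ k) → s j ≡ s′ j
    step j s≡s′ = begin
      s j                               ≡⟨ s-cons j ⟩
      parity (wOutDeg (build m s) j)    ≡⟨ cong parity (wOutDeg-build-cong m≗m′ s≡s′) ⟩
      parity (wOutDeg (build m′ s′) j)  ≡⟨ s′-cons j ⟨
      s′ j                              ∎
      where open ≡-Reasoning

  module _ (m : TMon n) where

    -- parity (wOutDeg (build m s) j), which only reads s above j.
    selectorStep : ∀ j → (∀ {k} → j Fin.< k → Parity) → Parity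
    selectorStep j s =
      parity (∑[ k < n ] when< j k λ j<k → bit (s (recompute (j Fin.<? k) j<k) ⁻¹) * m (t j k j<k))

    selector : Fin n → Parity
    selector = All.wfRec >-wellFounded 0ℓ (λ _ → Parity) selectorStep

    selector-consistent : Consistent m selector
    selector-consistent j = FixPoint.unfold-wfRec >-wellFounded (λ _ → Parity) selectorStep selectorStep-cong
      where
      selectorStep-cong : ∀ j {s s′ : ∀ {k} → j Fin.< k → Parity} →
                          (∀ {k} (j<k : j Fin.< k) → s j<k ≡ s′ j<k) → selectorStep j s ≡ selectorStep j s′
      selectorStep-cong j s≡s′ = cong parity (sum-cong-≗ {n} λ k → when<-cong λ j<k →
        cong (λ p → bit (p ⁻¹) * m (t j k j<k)) (s≡s′ (recompute (j Fin.<? k) j<k)))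

  evenWeight-build : {m : TMon n} {s : Fin n → Parity} → InT m → Consistent m s → EvenWeight (build m s)
  evenWeight-build {m} {s} m∈T s-cons j = begin
    parity (uvDeg (build m s) j + wOutDeg (build m s) j)
      ≡⟨ ℙ.+-homo-+ (uvDeg (build m s) j) _ ⟩
    parity (uvDeg (build m s) j) ℙ.+ parity (wOutDeg (build m s) j)
      ≡⟨ cong₂ ℙ._+_ uvDeg-parity (sym (s-cons j)) ⟩
    s j ℙ.+ s j
      ≡⟨ ℙ.p+p≡0ℙ (s j) ⟩
    0ℙ ∎
    where
    open ≡-Reasoning
    uvDeg-parity = trans (cong parity (uvDeg-build m∈T s j)) (parity-bit (s j))

  consistent-reconstruct : {y : VMon n} (y∈V : InV y) → EvenWeight y → Consistent (γ y) (parity ∘ uvDeg y)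
  consistent-reconstruct {y} y∈V even j = begin
    parity (uvDeg y j)                                   ≡⟨ ℙ.+-cancelʳ-≡ (parity (wOutDeg y j)) _ _ cancel ⟩
    parity (wOutDeg y j)                                 ≡⟨ cong parity (wOutDeg-cong (reconstruct y∈V) j) ⟩
    parity (wOutDeg (build (γ y) (parity ∘ uvDeg y)) j)  ∎
    where
    open ≡-Reasoning
    cancel : parity (uvDeg y j) ℙ.+ parity (wOutDeg y j) ≡ parity (wOutDeg y j) ℙ.+ parity (wOutDeg y j)
    cancel = trans (sym (ℙ.+-homo-+ (uvDeg y j) _)) (trans (even j) (sym (ℙ.p+p≡0ℙ (parity (wOutDeg y j)))))

  _≼_ : VMon n → VMon n → Set
  y′ ≼ y = ∀ x → y′ x ≤ y x

  InV-≼ : {y y′ : VMon n} → y′ ≼ y → InV y → InV y′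
  InV-≼ y′≼y y∈V = (λ x → ≤-trans (y′≼y x) (proj₁ y∈V x))
                  , λ x x′ same 1≤y′x 1≤y′x′ →
                      proj₂ y∈V x x′ same (≤-trans 1≤y′x (y′≼y x)) (≤-trans 1≤y′x′ (y′≼y x′))

  varMon-positive : (x z : VVar n) → 1 ≤ varMon x z → x ≡ z
  varMon-positive (u a) (u b) _ with a Fin.≟ b
  ... | yes refl = refl
  varMon-positive (v a b _) (v c d _) _ with a Fin.≟ c | b Fin.≟ d
  ... | yes refl | yes refl = refl
  varMon-positive (w a b _) (w c d _) _ with a Fin.≟ c | b Fin.≟ d
  ... | yes refl | yes refl = refl

  varMon≤1 : (x z : VVar n) → varMon x z ≤ 1
  varMon≤1 (u a)     (u b)     = δ≤1 a b
  varMon≤1 (v a b _) (v c d _) = *-mono-≤ (δ≤1 a c) (δ≤1 b d)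
  varMon≤1 (w a b _) (w c d _) = *-mono-≤ (δ≤1 a c) (δ≤1 b d)
  varMon≤1 (u _)     (v _ _ _) = z≤n
  varMon≤1 (u _)     (w _ _ _) = z≤n
  varMon≤1 (v _ _ _) (u _)     = z≤n
  varMon≤1 (v _ _ _) (w _ _ _) = z≤n
  varMon≤1 (w _ _ _) (u _)     = z≤n
  varMon≤1 (w _ _ _) (v _ _ _) = z≤n

  varMon-≼ : (y : VMon n) (x : VVar n) → 1 ≤ y x → varMon x ≼ y
  varMon-≼ y x 1≤yx z with 1 ≤? varMon x z
  ... | no  1≰ = ≤-trans (≤-reflexive (1≰⇒≡0 1≰)) z≤n
  ... | yes 1≤ with refl ← varMon-positive x z 1≤ = ≤-trans (varMon≤1 x x) 1≤yx

  pair-≼ : {y : VMon n} {x x′ : VVar n} → x ≢ x′ → 1 ≤ y x → 1 ≤ y x′ → (varMon x · varMon x′) ≼ y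
  pair-≼ {y} {x} {x′} x≢x′ 1≤yx 1≤yx′ z with 1 ≤? varMon x′ z
  ... | no  1≰ = ≤-trans (≤-reflexive (trans (cong (varMon x z +_) (1≰⇒≡0 1≰)) (+-identityʳ _)))
                         (varMon-≼ y x 1≤yx z)
  ... | yes 1≤ with refl ← varMon-positive x′ z 1≤ =
    ≤-trans (≤-reflexive (cong (_+ varMon x′ x′) (1≰⇒≡0 (x≢x′ ∘ varMon-positive x x′))))
            (varMon-≼ y x′ 1≤yx′ x′)

  split-off-uv : {y : VMon n} {j : Fin n} → 1 ≤ uvDeg y j → 1 ≤ wOutDeg y j → ∃ λ q → qMon q ≼ y
  split-off-uv {y} {j} 1≤uvDeg 1≤wOutDeg with uvDeg-positive y j 1≤uvDeg | wOutDeg-positive y j 1≤wOutDeg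
  ... | inj₁ 1≤yu             | k , j<k , 1≤yw = uw j k j<k , pair-≼ (λ ()) 1≤yu 1≤yw
  ... | inj₂ (i , i<j , 1≤yv) | k , j<k , 1≤yw = vw i j k i<j j<k , pair-≼ (λ ()) 1≤yv 1≤yw

  split-off-ww : {y : VMon n} {j : Fin n} → InV y → 2 ≤ wOutDeg y j → ∃ λ q → qMon q ≼ y
  split-off-ww {y} {j} y∈V 2≤wOutDeg =
    let k  , 1≤wₖ         = ∃-positive-term (wOutSlot y j) (≤-trans (s≤s z≤n) 2≤wOutDeg)
        k′ , k′≢k , 1≤wₖ′ = ∃-other-positive-term (wOutSlot y j) k
                              (<-≤-trans (s≤s (when<-≤ λ _ → proj₁ y∈V _)) 2≤wOutDeg)
        j<k  , 1≤yw  = when<-positive 1≤wₖ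
        j<k′ , 1≤yw′ = when<-positive 1≤wₖ′
    in case Fin.<-cmp k k′ of λ where
         (tri< k<k′ _ _) → ww j k k′ j<k k<k′ , pair-≼ (k′≢k ∘ sym ∘ cong vBlock) 1≤yw 1≤yw′
         (tri≈ _ k≡k′ _) → contradiction (sym k≡k′) k′≢k
         (tri> _ _ k′<k) → ww j k′ k j<k′ k′<k , pair-≼ (k′≢k ∘ cong vBlock) 1≤yw′ 1≤yw

  even⇒2≤ : ∀ {a} → parity a ≡ 0ℙ → 1 ≤ a → 2 ≤ a
  even⇒2≤ {0}           _  ()
  even⇒2≤ {1}           () _
  even⇒2≤ {suc (suc a)} _  _ = s≤s (s≤s z≤n)

  split-off : {y : VMon n} → InV y → EvenWeight y → ∀ {j} → 1 ≤ weight y j → ∃ λ q → qMon q ≼ y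
  split-off {y} y∈V even {j} 1≤weight with 1 ≤? uvDeg y j | even⇒2≤ (even j) 1≤weight
  ... | yes 1≤uvDeg | 2≤weight =
    split-off-uv 1≤uvDeg (+-cancelˡ-≤ 1 1 _ (≤-trans 2≤weight (+-monoˡ-≤ _ (uvDeg≤1 y∈V j))))
  ... | no  1≰uvDeg | 2≤weight =
    split-off-ww y∈V (≤-trans 2≤weight (≤-reflexive (cong (_+ wOutDeg y j) (1≰⇒≡0 1≰uvDeg))))

  totalWeight : VMon n → ℕ
  totalWeight y = ∑[ j < n ] weight y j

  totalWeight-· : (y y′ : VMon n) → totalWeight (y · y′) ≡ totalWeight y + totalWeight y′
  totalWeight-· y y′ = trans (sum-cong-≗ {n} (weight-· y y′)) (∑-distrib-+ (weight y) (weight y′))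

  1≤totalWeight-qMon : (q : QElem n) → 1 ≤ totalWeight (qMon q)
  1≤totalWeight-qMon q = begin
    1                      ≤⟨ s≤s z≤n ⟩
    1 + 1                  ≡⟨ cong₂ _+_ (δ-refl c) (δ-refl c) ⟨
    δ c c + δ c c          ≡⟨ weight-qMon q c ⟨
    weight (qMon q) c      ≤⟨ term≤sum (weight (qMon q)) c ⟩
    totalWeight (qMon q)   ∎
    where
    open ≤-Reasoning
    c = qAnchor q

  ≤weight-anchor : (y : VMon n) (x : VVar n) → y x ≤ weight y (anchor x)
  ≤weight-anchor y (u j)       = ≤-trans (u≤uvDeg y j) (m≤m+n _ _)
  ≤weight-anchor y (v i j i<j) = ≤-trans (v≤uvDeg y i<j) (m≤m+n _ _)
  ≤weight-anchor y (w i j i<j) = ≤-trans (w≤wOutDeg y i<j) (m≤n+m _ _)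

  _/_ : VMon n → VMon n → VMon n
  (y / y′) x = y x ∸ y′ x

  /-≼ : (y y′ : VMon n) → (y / y′) ≼ y
  /-≼ y y′ x = m∸n≤m (y x) (y′ x)

  /-split : {y y′ : VMon n} → y′ ≼ y → y′ · (y / y′) ≗ y
  /-split y′≼y x = m+[n∸m]≡n (y′≼y x)

  totalWeight-/ : {y y′ : VMon n} → y′ ≼ y → 1 ≤ totalWeight y′ →
                  totalWeight (y / y′) < totalWeight y
  totalWeight-/ {y} {y′} y′≼y 1≤tw′ = begin-strict
    totalWeight (y / y′)                   <⟨ m<n+m _ 1≤tw′ ⟩
    totalWeight y′ + totalWeight (y / y′)  ≡⟨ totalWeight-· y′ (y / y′) ⟨
    totalWeight (y′ · (y / y′))            ≡⟨ sum-cong-≗ {n} (weight-cong (/-split y′≼y)) ⟩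
    totalWeight y                          ∎
    where open ≤-Reasoning

  decompose-bounded : ∀ N {y} → totalWeight y < N → InV y → EvenWeight y → InProdQ y
  decompose-bounded (suc N) {y} tw<N y∈V even with 1 ≤? totalWeight y
  ... | no 1≰tw = [] , λ x → sym (n≤0⇒n≡0 (begin
    y x                  ≤⟨ ≤weight-anchor y x ⟩
    weight y (anchor x)  ≤⟨ term≤sum (weight y) (anchor x) ⟩
    totalWeight y        ≡⟨ 1≰⇒≡0 1≰tw ⟩
    0                    ∎))
    where open ≤-Reasoning
  ... | yes 1≤tw with split-off y∈V even (proj₂ (∃-positive-term (weight y) 1≤tw))
  ...   | q , q≼y with decompose-bounded N
                         (<-≤-trans (totalWeight-/ q≼y (1≤totalWeight-qMon q)) (s≤s⁻¹ tw<N))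
                         (InV-≼ (/-≼ y (qMon q)) y∈V)
                         (evenWeight-cancelˡ {qMon q} {y / qMon q} (evenWeight-qMon q)
                                             (evenWeight-cong (sym ∘ /-split q≼y) even))
  ...     | qs , qs≗y/q = q ∷ qs , λ x → trans (cong (qMon q x +_) (qs≗y/q x)) (/-split q≼y x)

  decompose : {y : VMon n} → InV y → EvenWeight y → InProdQ y
  decompose {y} = decompose-bounded (suc (totalWeight y)) ≤-refl

  φ : TMon n → VMon n
  φ m = build m (selector m)

  φ-InV : {m : TMon n} → InT m → InV (φ m)
  φ-InV {m} m∈T = build-InV m∈T (selector m)

  φ-InProdQ : {m : TMon n} → InT m → InProdQ (φ m)
  φ-InProdQ {m} m∈T = decompose (φ-InV m∈T) (evenWeight-build m∈T (selector-consistent m))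

  γ-φ : (m : TMon n) → γ (φ m) ≗ m
  γ-φ m = γ-build m (selector m)

  φ-injective : {m m′ : TMon n} → φ m ≗ φ m′ → m ≗ m′
  φ-injective {m} {m′} φm≗φm′ x = trans (sym (γ-φ m x)) (trans (γ-cong φm≗φm′ x) (γ-φ m′ x))

  φ-cong : {m m′ : TMon n} → m ≗ m′ → φ m ≗ φ m′
  φ-cong {m} {m′} m≗m′ = build-cong m≗m′ (consistent-unique m≗m′ (selector-consistent m) (selector-consistent m′))

  φ-γ : {m : TMon n} {y : VMon n} → InV y → InProdQ y → m ≗ γ y → φ m ≗ y
  φ-γ {m} y∈V y∈∏Q m≗γy x = trans
    (build-cong m≗γy (consistent-unique m≗γy (selector-consistent m)
                        (consistent-reconstruct y∈V (InProdQ⇒EvenWeight y∈∏Q))) x)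
    (sym (reconstruct y∈V x))

lemma5p2 : (n : ℕ) →
    Σ (Bijection (𝒯 n) (𝒱∩∏𝒬 n))
      (λ φ → ∀ m → γ (proj₁ (Bijection.to φ m)) ≗ proj₁ m)
lemma5p2 n = bijection , λ (m , _) → γ-φ m
  where
  to : Setoid.Carrier (𝒯 n) → Setoid.Carrier (𝒱∩∏𝒬 n)
  to (m , m∈T) = φ m , φ-InV m∈T , φ-InProdQ m∈T

  bijection : Bijection (𝒯 n) (𝒱∩∏𝒬 n)
  bijection = record
    { to        = to
    ; cong      = φ-cong
    ; bijective = φ-injective , λ (y , y∈V , y∈∏Q) → (γ y , γ-InT y∈V) , φ-γ y∈V y∈∏Q
    }
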